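{- Let $G$ be a sparse graph and let $(A,C,B)$ be a separation of $G$ with $A\neq\emptyset$ and $B\neq\emptyset$. Suppose there exist $v_1,\dots,v_k\in C$ such that $C\subseteq\bigcup_{i=1}^k N[v_i]$. Let $D_1$ be a component of $G[A]$ and $D_2$ a component of $G[B]$. Then there exist cliques $X_1,\dots,X_k\subseteq C$ of $G$ such that every path from a vertex of $D_1$ to a vertex of $D_2$ meets $\bigcup_{i=1}^k X_i$. In particular, if $G$ admits a star cutset, then $G$ admits a clique cutset.
   Context: A hole is an induced cycle of length at least four. $G$ is sparse if for every hole $H$ and vertex $v\notin V(H)$ there is an edge $ab$ of $H$ with $N(v)\cap V(H)\subseteq\{a,b\}$. A separation of $G$ is a triple $(A,C,B)$ of pairwise disjoint sets with union $V(G)$ and $A$ anticomplete to $B$ (no edges between them). $C$ is a cutset if some separation $(A,C,B)$ has $A,B\neq\emptyset$; a clique cutset is a cutset that is a clique. A separation $(A,C,B)$ is a star separation if some $v\in C$ satisfies $C\subseteq N[v]$; it is proper if $A,B\ne\emptyset$; $G$ admits a star cutset if it has a proper star separation. $N[v]$ is the closed neighborhood. -}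

module Defs where

open import Data.Nat using (ℕ; zero; suc; _≤_; _∸_)
open import Data.Fin using (Fin; toℕ)
open import Data.Fin.Subset using (Subset; _∈_; _∉_; _⊆_)
open import Data.List using (List; []; _∷_)
open import Data.List.Relation.Unary.Any using (Any)
open import Data.List.Relation.Unary.All using (All)
open import Data.List.Relation.Unary.Unique.Propositional using (Unique)
open import Data.Product using (Σ; ∃; ∃-syntax; _×_; _,_)
open import Data.Sum using (_⊎_)
open import Data.Empty using (⊥)
open import Relation.Nullary using (¬_; Dec)
open import Relation.Binary.PropositionalEquality using (_≡_; _≢_)

record Graph (n : ℕ) : Set₁ where
  field
    Adj   : Fin n → Fin n → Set
    adj?  : ∀ u v → Dec (Adj u v)
    sym   : ∀ {u v} → Adj u v → Adj v u
    irrefl : ∀ {u} → ¬ Adj u u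

module _ {n : ℕ} (G : Graph n) where
  open Graph G

  N[_] : Fin n → Fin n → Set
  N[ v ] u = u ≡ v ⊎ Adj u v

  Consecutive : ∀ {m} → Fin m → Fin m → Set
  Consecutive {m} i j =
      suc (toℕ i) ≡ toℕ j
    ⊎ suc (toℕ j) ≡ toℕ i
    ⊎ (toℕ i ≡ 0 × toℕ j ≡ m ∸ 1)
    ⊎ (toℕ j ≡ 0 × toℕ i ≡ m ∸ 1)

  record Hole : Set where
    field
      len    : ℕ
      long   : 4 ≤ len
      vtx    : Fin len → Fin n
      inj    : ∀ i j → vtx i ≡ vtx j → i ≡ j
      edges  : ∀ i j → Consecutive i j → Adj (vtx i) (vtx j)
      nonedges : ∀ i j → ¬ Consecutive i j → ¬ Adj (vtx i) (vtx j)

  Sparse : Set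
  Sparse = ∀ (H : Hole) (v : Fin n) → (∀ i → Hole.vtx H i ≢ v) →
    let open Hole H in
    ∃[ i ] ∃[ j ] (Consecutive i j ×
      (∀ l → Adj v (vtx l) → l ≡ i ⊎ l ≡ j))

  data Walk : Fin n → Fin n → Set where
    [_]  : ∀ v → Walk v v
    _∷⟨_⟩_ : ∀ u {v w} → Adj u v → Walk v w → Walk u w

  vertices : ∀ {u v} → Walk u v → List (Fin n)
  vertices [ v ] = v ∷ []
  vertices (u ∷⟨ _ ⟩ p) = u ∷ vertices p

  IsPath : ∀ {u v} → Walk u v → Set
  IsPath p = Unique (vertices p)

  Separation : Subset n → Subset n → Subset n → Set
  Separation A C B =
      (∀ v → v ∈ A → v ∉ C) × (∀ v → v ∈ A → v ∉ B) × (∀ v → v ∈ C → v ∉ B)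
    × (∀ v → v ∈ A ⊎ v ∈ C ⊎ v ∈ B)
    × (∀ u v → u ∈ A → v ∈ B → ¬ Adj u v)

  NonEmpty : Subset n → Set
  NonEmpty S = ∃[ v ] v ∈ S

  IsClique : Subset n → Set
  IsClique X = ∀ u v → u ∈ X → v ∈ X → u ≢ v → Adj u v

  IsComponentOf : Subset n → Subset n → Set
  IsComponentOf D S =
      D ⊆ S
    × NonEmpty D
    × (∀ u v → u ∈ D → v ∈ D →
         ∃[ p ] (IsPath {u} {v} p × All (_∈ D) (vertices p)))
    × (∀ u v → u ∈ D → v ∈ S → Adj u v → v ∈ D)

  IsStarSeparation : Subset n → Subset n → Subset n → Set
  IsStarSeparation A C B = Separation A C B × ∃[ v ] (v ∈ C × ∀ u → u ∈ C → N[ v ] u)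

  AdmitsStarCutset : Set
  AdmitsStarCutset = ∃[ A ] ∃[ C ] ∃[ B ]
    (IsStarSeparation A C B × NonEmpty A × NonEmpty B)

  AdmitsCliqueCutset : Set
  AdmitsCliqueCutset = ∃[ A ] ∃[ C ] ∃[ B ]
    (Separation A C B × NonEmpty A × NonEmpty B × IsClique C)

{-# OPTIONS --safe #-}
-- For each i let F be the part of G − (D₁ ∪ N(D₁) ∪ {v i}) that is reachable from D₂,
-- and let X i consist of v i and those neighbours of v i in N(D₁) with a neighbour in F.
-- If x, y ∈ X i were non-adjacent, an induced path running from the last neighbour of x
-- on a D₁-path to y, then through F back to the last neighbour of x there, would close
-- with x into a hole on which v i sees the non-adjacent x and y; sparseness forbids this. On a walk from D₁ to D₂ the last vertex c in N(D₁) lies in C, so c ∈ N[v i] for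
-- some i: either v i lies on the rest of the walk, or that rest runs inside F and c ∈ X i.
-- For a star cutset (k = 1) the single clique X i therefore separates D₁ from D₂.
module Submission where

open import Defs
open import Data.Nat as ℕ using (ℕ; zero; suc; _≤_; _≤′_)
open import Data.Nat.Properties as ℕ using ()
open import Data.Fin using (Fin; zero; suc; toℕ; _≟_)
open import Data.Fin.Properties using (injective⇒≤; any?)
open import Data.Fin.Subset using (Subset; _∈_; _∉_; _⊆_)
open import Data.Fin.Subset.Properties using (_∈?_)
open import Data.Vec using (tabulate)
open import Data.Vec.Properties using (lookup∘tabulate; []=⇒lookup; lookup⇒[]=)
open import Data.List using (List; []; _∷_; length; lookup)
open import Data.List.Relation.Unary.Any as Any using (Any; here; there)
open import Data.List.Relation.Unary.Any.Properties using (lookup-index)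
open import Data.List.Relation.Unary.All as All using (All; []; _∷_)
open import Data.List.Relation.Unary.All.Properties using (All¬⇒¬Any; ¬Any⇒All¬)
open import Data.List.Relation.Unary.AllPairs using ([]; _∷_)
open import Data.List.Relation.Unary.Unique.Propositional using (Unique)
open import Data.List.Membership.Propositional using () renaming (_∈_ to _∈ᴸ_)
open import Data.List.Membership.Propositional.Properties using (∈-lookup)
open import Data.List.Relation.Binary.Subset.Propositional using () renaming (_⊆_ to _⊆ᴸ_)
open import Data.List.Relation.Binary.Subset.Propositional.Properties using (All-resp-⊇; Any-resp-⊆)
open import Data.Product using (Σ; ∃; ∃-syntax; _×_; _,_; proj₁; proj₂)
open import Data.Sum using (_⊎_; inj₁; inj₂) renaming (map to ⊎-map)
open import Data.Empty using (⊥-elim)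
open import Data.Unit using (⊤; tt)
open import Function using (_∘_; id)
open import Relation.Nullary using (¬_; yes; no; does)
open import Relation.Nullary.Decidable using (dec-true; map′; _×-dec_; _⊎-dec_; ¬?)
open import Relation.Unary using (Decidable)
open import Relation.Binary.PropositionalEquality

lookup-injective : ∀ {A : Set} {xs : List A} → Unique xs →
                   ∀ i j → lookup xs i ≡ lookup xs j → i ≡ j
lookup-injective (_ ∷ _) zero zero _ = refl
lookup-injective (x∉xs ∷ _) zero (suc j) eq = ⊥-elim (All.lookup x∉xs (∈-lookup j) eq)
lookup-injective (x∉xs ∷ _) (suc i) zero eq = ⊥-elim (All.lookup x∉xs (∈-lookup i) (sym eq))
lookup-injective (_ ∷ u) (suc i) (suc j) eq = cong suc (lookup-injective u i j eq)

Unique⇒length≤ : ∀ {n} {xs : List (Fin n)} → Unique xs → length xs ≤ n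
Unique⇒length≤ u = injective⇒≤ (lookup-injective u _ _)

Any-map-All : ∀ {A : Set} {P Q : A → Set} {xs : List A} →
              All (λ x → P x → Q x) xs → Any P xs → Any Q xs
Any-map-All (f ∷ _) (here px) = here (f px)
Any-map-All (_ ∷ fs) (there pxs) = there (Any-map-All fs pxs)

module _ {n : ℕ} {P : Fin n → Set} (P? : Decidable P) where

  toSubset : Subset n
  toSubset = tabulate (does ∘ P?)

  ∈-toSubset⁺ : ∀ {x} → P x → x ∈ toSubset
  ∈-toSubset⁺ {x} p = lookup⇒[]= x _ (trans (lookup∘tabulate _ x) (dec-true (P? x) p))

  ∈-toSubset⁻ : ∀ {x} → x ∈ toSubset → P x
  ∈-toSubset⁻ {x} x∈ with P? x | trans (sym (lookup∘tabulate _ x)) ([]=⇒lookup x∈)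
  ... | yes p | _ = p
  ... | no _ | ()

module WalkProperties {n : ℕ} (G : Graph n) where
  open Graph G renaming (sym to Adj-sym)

  private
    vs : ∀ {u v} → Walk G u v → List (Fin n)
    vs = vertices G

  tail : ∀ {u v} → Walk G u v → List (Fin n)
  tail [ _ ] = []
  tail (_ ∷⟨ _ ⟩ p) = vs p

  steps : ∀ {u v} → Walk G u v → ℕ
  steps [ _ ] = 0
  steps (_ ∷⟨ _ ⟩ p) = suc (steps p)

  length-vertices : ∀ {u v} (p : Walk G u v) → length (vs p) ≡ suc (steps p)
  length-vertices [ _ ] = refl
  length-vertices (_ ∷⟨ _ ⟩ p) = cong suc (length-vertices p)

  _++ʷ_ : ∀ {u v w} → Walk G u v → Walk G v w → Walk G u w
  [ _ ] ++ʷ q = q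
  (u ∷⟨ e ⟩ p) ++ʷ q = u ∷⟨ e ⟩ (p ++ʷ q)

  reverse : ∀ {u v} → Walk G u v → Walk G v u
  reverse [ v ] = [ v ]
  reverse (u ∷⟨ e ⟩ p) = reverse p ++ʷ (_ ∷⟨ Adj-sym e ⟩ [ u ])

  module _ {P : Fin n → Set} where

    All-head : ∀ {u v} (p : Walk G u v) → All P (vs p) → P u
    All-head [ _ ] (pu ∷ _) = pu
    All-head (_ ∷⟨ _ ⟩ _) (pu ∷ _) = pu

    All-head∷tail : ∀ {u v} (p : Walk G u v) → P u → All P (tail p) → All P (vs p)
    All-head∷tail [ _ ] pu _ = pu ∷ []
    All-head∷tail (_ ∷⟨ _ ⟩ _) pu ps = pu ∷ ps

    Any-head : ∀ {u v} (p : Walk G u v) → P u → Any P (vs p)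
    Any-head [ _ ] pu = here pu
    Any-head (_ ∷⟨ _ ⟩ _) pu = here pu

    All-++ʷ : ∀ {u v w} (p : Walk G u v) (q : Walk G v w) →
              All P (vs p) → All P (vs q) → All P (vs (p ++ʷ q))
    All-++ʷ [ _ ] q _ ps = ps
    All-++ʷ (_ ∷⟨ _ ⟩ p) q (pu ∷ ps) qs = pu ∷ All-++ʷ p q ps qs

    All-reverse : ∀ {u v} (p : Walk G u v) → All P (vs p) → All P (vs (reverse p))
    All-reverse [ _ ] ps = ps
    All-reverse (_ ∷⟨ _ ⟩ p) (pu ∷ ps) =
      All-++ʷ (reverse p) _ (All-reverse p ps) (All-head p ps ∷ pu ∷ [])

  last∈vertices : ∀ {u v} (p : Walk G u v) → v ∈ᴸ vs p
  last∈vertices [ _ ] = here refl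
  last∈vertices (_ ∷⟨ _ ⟩ p) = there (last∈vertices p)

  Boundary : (Fin n → Set) → Fin n → Set
  Boundary D w = ¬ D w × ∃ λ d → D d × Adj w d

  module _ {D : Fin n → Set} (D? : Decidable D) where

    boundary? : Decidable (Boundary D)
    boundary? w = ¬? (D? w) ×-dec any? (λ d → D? d ×-dec adj? w d)

    leaving-walk-meets-boundary : ∀ {u v} (p : Walk G u v) → D u → ¬ D v → Any (Boundary D) (vs p)
    leaving-walk-meets-boundary [ _ ] du ¬dv = ⊥-elim (¬dv du)
    leaving-walk-meets-boundary (_∷⟨_⟩_ u {w} e p) du ¬dv with D? w
    ... | yes dw = there (leaving-walk-meets-boundary p dw ¬dv)
    ... | no ¬dw = there (Any-head p (¬dw , u , du , Adj-sym e))

  boundary-avoiding-walk-stays-outside : ∀ {D : Fin n → Set} {u v} (p : Walk G u v) → ¬ D v →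
                                         All (¬_ ∘ Boundary D) (vs p) → All (¬_ ∘ D) (vs p)
  boundary-avoiding-walk-stays-outside [ _ ] ¬dv _ = ¬dv ∷ []
  boundary-avoiding-walk-stays-outside (u ∷⟨ e ⟩ p) ¬dv (_ ∷ p∌∂) =
    (λ du → All-head p p∌∂ (All-head p outside , u , du , Adj-sym e)) ∷ outside
    where
      outside : All (¬_ ∘ _) (vs p)
      outside = boundary-avoiding-walk-stays-outside p ¬dv p∌∂

  IsInducedPath : ∀ {u v} → Walk G u v → Set
  IsInducedPath [ _ ] = ⊤
  IsInducedPath (u ∷⟨ _ ⟩ p) =
    All (u ≢_) (vs p) × All (λ w → ¬ Adj u w) (tail p) × IsInducedPath p

  IsInducedPath⇒IsPath : ∀ {u v} (p : Walk G u v) → IsInducedPath p → IsPath G p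
  IsInducedPath⇒IsPath [ _ ] _ = [] ∷ []
  IsInducedPath⇒IsPath (_ ∷⟨ _ ⟩ p) (u∉p , _ , ind) = u∉p ∷ IsInducedPath⇒IsPath p ind

  data Suffix {c v} (q : Walk G c v) : ∀ {u} → Walk G u v → Set where
    here  : Suffix q q
    there : ∀ {u w} {e : Adj u w} {p : Walk G w v} → Suffix q p → Suffix q (u ∷⟨ e ⟩ p)

  Suffix⇒⊆ : ∀ {c u v} {q : Walk G c v} {p : Walk G u v} → Suffix q p → vs q ⊆ᴸ vs p
  Suffix⇒⊆ here = id
  Suffix⇒⊆ (there s) = there ∘ Suffix⇒⊆ s

  Suffix-induced : ∀ {c u v} {q : Walk G c v} {p : Walk G u v} →
                   Suffix q p → IsInducedPath p → IsInducedPath q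
  Suffix-induced here ind = ind
  Suffix-induced (there s) (_ , _ , ind) = Suffix-induced s ind

  record LastSatisfying {u v} (P : Fin n → Set) (p : Walk G u v) : Set where
    constructor lastSatisfying
    field
      {start}  : Fin n
      suffix   : Walk G start v
      isSuffix : Suffix suffix p
      holds    : P start
      fails    : All (¬_ ∘ P) (tail suffix)

  lastSatisfying? : ∀ {P : Fin n → Set} → Decidable P →
                    ∀ {u v} (p : Walk G u v) → Any P (vs p) → LastSatisfying P p
  lastSatisfying? P? [ v ] (here pv) = lastSatisfying [ v ] here pv []
  lastSatisfying? P? (u ∷⟨ e ⟩ p) P∈ with Any.any? P? (vs p)
  ... | yes P∈p = let lastSatisfying q s pq fq = lastSatisfying? P? p P∈p
                  in lastSatisfying q (there s) pq fq
  ... | no P∉p with P∈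
  ...   | here pu = lastSatisfying (u ∷⟨ e ⟩ p) here pu (¬Any⇒All¬ _ P∉p)
  ...   | there P∈p = ⊥-elim (P∉p P∈p)

  record LastNeighbourSegment (x : Fin n) (P : Fin n → Set) (v : Fin n) : Set where
    constructor segment
    field
      {start}      : Fin n
      walk         : Walk G start v
      x~start      : Adj x start
      inside       : All P (vs walk)
      x~walk⇒start : All (λ w → Adj x w → w ≡ start) (vs walk)

  lastNeighbourSegment : ∀ {P : Fin n → Set} x {u v} (p : Walk G u v) → Adj x u → All P (vs p) →
                         LastNeighbourSegment x P v
  lastNeighbourSegment x p x~u p⊆P =
    let lastSatisfying q q⊆p x~a x≁tail = lastSatisfying? (adj? x) p (Any-head p x~u)
    in segment q x~a (All-resp-⊇ (Suffix⇒⊆ q⊆p) p⊆P)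
         (All-head∷tail q (λ _ → refl) (All.map (λ x≁w x~w → ⊥-elim (x≁w x~w)) x≁tail))

  record InducedSubpath {u v} (p : Walk G u v) : Set where
    constructor inducedSubpath
    field
      path    : Walk G u v
      induced : IsInducedPath path
      ⊆walk   : vs path ⊆ᴸ vs p

  shortcut : ∀ {u v} (p : Walk G u v) → InducedSubpath p
  shortcut [ v ] = inducedSubpath [ v ] tt id
  shortcut (u ∷⟨ e ⟩ p) with shortcut p
  ... | inducedSubpath q ind q⊆p with Any.any? (u ≟_) (vs q)
  ...   | yes u∈q with lastSatisfying? (u ≟_) q u∈q
  ...     | lastSatisfying q′ s refl _ =
    inducedSubpath q′ (Suffix-induced s ind) (there ∘ q⊆p ∘ Suffix⇒⊆ s)
  shortcut (u ∷⟨ e ⟩ p) | inducedSubpath q ind q⊆p | no u∉q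
    with lastSatisfying? (adj? u) q (Any-head q e)
  ... | lastSatisfying q′ s u~c fails =
    inducedSubpath (u ∷⟨ u~c ⟩ q′)
      (¬Any⇒All¬ _ (u∉q ∘ Suffix⇒⊆ s) , fails , Suffix-induced s ind)
      λ { (here eq) → here eq ; (there w∈q′) → there (q⊆p (Suffix⇒⊆ s w∈q′)) }

module Reachability {n : ℕ} (G : Graph n) where
  open Graph G renaming (sym to Adj-sym)
  open WalkProperties G

  record ReachesWithin (M T : Fin n → Set) (w : Fin n) : Set where
    constructor reaches
    field
      {target} : Fin n
      walk     : Walk G w target
      inside   : All M (vertices G walk)
      arrives  : T target

  module _ {M T : Fin n → Set} where

    reaches-∷ : ∀ {w u} → M w → Adj w u → ReachesWithin M T u → ReachesWithin M T w
    reaches-∷ mw e (reaches p ps t) = reaches (_ ∷⟨ e ⟩ p) (mw ∷ ps) t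

    All-reaches : ∀ {w t} (p : Walk G w t) → All M (vertices G p) → T t →
                  All (ReachesWithin M T) (vertices G p)
    All-reaches [ _ ] ps t = reaches [ _ ] ps t ∷ []
    All-reaches (_ ∷⟨ e ⟩ p) (mw ∷ ps) t =
      reaches (_ ∷⟨ e ⟩ p) (mw ∷ ps) t ∷ All-reaches p ps t

  module _ {M T : Fin n → Set} (M? : Decidable M) (T? : Decidable T) where
    private
      ReachesInSteps : ℕ → Fin n → Set
      ReachesInSteps zero w = M w × T w
      ReachesInSteps (suc s) w =
        ReachesInSteps s w ⊎ (M w × ∃ λ u → Adj w u × ReachesInSteps s u)

      reachesInSteps? : ∀ s → Decidable (ReachesInSteps s)
      reachesInSteps? zero w = M? w ×-dec T? w
      reachesInSteps? (suc s) w =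
        reachesInSteps? s w ⊎-dec (M? w ×-dec any? (λ u → adj? w u ×-dec reachesInSteps? s u))

      sound : ∀ s {w} → ReachesInSteps s w → ReachesWithin M T w
      sound zero (mw , tw) = reaches [ _ ] (mw ∷ []) tw
      sound (suc s) (inj₁ r) = sound s r
      sound (suc s) (inj₂ (mw , _ , e , r)) = reaches-∷ mw e (sound s r)

      complete : ∀ {w t} (p : Walk G w t) → All M (vertices G p) → T t →
                 ReachesInSteps (steps p) w
      complete [ _ ] (mw ∷ []) t = mw , t
      complete (_ ∷⟨ e ⟩ p) (mw ∷ ps) t = inj₂ (mw , _ , e , complete p ps t)

      weaken : ∀ {s s′} → s ≤′ s′ → ∀ {w} → ReachesInSteps s w → ReachesInSteps s′ w
      weaken ℕ.≤′-refl r = r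
      weaken (ℕ.≤′-step s≤s′) r = inj₁ (weaken s≤s′ r)

      steps≤n : ∀ {u v} (p : Walk G u v) → IsInducedPath p → steps p ≤ n
      steps≤n p ind = ℕ.<⇒≤ (subst (_≤ n) (length-vertices p)
                              (Unique⇒length≤ (IsInducedPath⇒IsPath p ind)))

      bounded : ∀ {w} → ReachesWithin M T w → ReachesInSteps n w
      bounded (reaches p ps t) =
        let inducedSubpath q ind q⊆p = shortcut p
        in weaken (ℕ.≤⇒≤′ (steps≤n q ind)) (complete q (All-resp-⊇ q⊆p ps) t)

    reachesWithin? : Decidable (ReachesWithin M T)
    reachesWithin? w = map′ (sound n) bounded (reachesInSteps? n w)

module HoleProperties {n : ℕ} (G : Graph n) where
  open Graph G renaming (sym to Adj-sym)
  open WalkProperties G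

  private
    vs : ∀ {u v} → Walk G u v → List (Fin n)
    vs = vertices G

  Consecutive-sym : ∀ {m} {i j : Fin m} → Consecutive G i j → Consecutive G j i
  Consecutive-sym (inj₁ h) = inj₂ (inj₁ h)
  Consecutive-sym (inj₂ (inj₁ h)) = inj₁ h
  Consecutive-sym (inj₂ (inj₂ (inj₁ h))) = inj₂ (inj₂ (inj₂ h))
  Consecutive-sym (inj₂ (inj₂ (inj₂ h))) = inj₂ (inj₂ (inj₁ h))

  sparse⇒neighbours-on-hole-adjacent :
    Sparse G → (H : Hole G) → let open Hole H in
    ∀ v → (∀ i → vtx i ≢ v) → ∀ i j → Adj v (vtx i) → Adj v (vtx j) →
    i ≡ j ⊎ Adj (vtx i) (vtx j)
  sparse⇒neighbours-on-hole-adjacent sparse H v v∉H i j v~i v~j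
    with sparse H v v∉H
  ... | i′ , j′ , c , onlyEnds with onlyEnds i v~i | onlyEnds j v~j
  ...   | inj₁ refl | inj₁ refl = inj₁ refl
  ...   | inj₁ refl | inj₂ refl = inj₂ (Hole.edges H i′ j′ c)
  ...   | inj₂ refl | inj₁ refl = inj₂ (Hole.edges H j′ i′ (Consecutive-sym c))
  ...   | inj₂ refl | inj₂ refl = inj₁ refl

  lookup-first : ∀ {a b} (Q : Walk G a b) i → toℕ i ≡ 0 → lookup (vs Q) i ≡ a
  lookup-first [ _ ] zero _ = refl
  lookup-first (_ ∷⟨ _ ⟩ _) zero _ = refl

  lookup-last : ∀ {a b} (Q : Walk G a b) i → suc (toℕ i) ≡ length (vs Q) → lookup (vs Q) i ≡ b
  lookup-last [ _ ] zero _ = refl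
  lookup-last (_ ∷⟨ _ ⟩ p) zero h with trans (ℕ.suc-injective h) (length-vertices p)
  ... | ()
  lookup-last (_ ∷⟨ _ ⟩ p) (suc i) h = lookup-last p i (ℕ.suc-injective h)

  lookup-first⁻ : ∀ {a b} (Q : Walk G a b) → IsInducedPath Q →
                  ∀ i → lookup (vs Q) i ≡ a → toℕ i ≡ 0
  lookup-first⁻ [ _ ] _ zero _ = refl
  lookup-first⁻ (_ ∷⟨ _ ⟩ _) _ zero _ = refl
  lookup-first⁻ (_ ∷⟨ _ ⟩ p) (a∉p , _) (suc i) eq =
    ⊥-elim (All.lookup a∉p (∈-lookup i) (sym eq))

  lookup-last⁻ : ∀ {a b} (Q : Walk G a b) → IsInducedPath Q →
                 ∀ i → lookup (vs Q) i ≡ b → suc (toℕ i) ≡ length (vs Q)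
  lookup-last⁻ [ _ ] _ zero _ = refl
  lookup-last⁻ (_ ∷⟨ _ ⟩ p) (a∉p , _) zero eq = ⊥-elim (All.lookup a∉p (last∈vertices p) eq)
  lookup-last⁻ (_ ∷⟨ _ ⟩ p) (_ , _ , ind) (suc i) eq = cong suc (lookup-last⁻ p ind i eq)

  lookup-successor-adjacent : ∀ {a b} (Q : Walk G a b) i j → suc (toℕ i) ≡ toℕ j →
                              Adj (lookup (vs Q) i) (lookup (vs Q) j)
  lookup-successor-adjacent [ _ ] zero zero ()
  lookup-successor-adjacent (_ ∷⟨ _ ⟩ _) zero zero ()
  lookup-successor-adjacent (_ ∷⟨ _ ⟩ _) (suc _) zero ()
  lookup-successor-adjacent (_ ∷⟨ e ⟩ p) zero (suc j) h =
    subst (Adj _) (sym (lookup-first p j (sym (ℕ.suc-injective h)))) e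
  lookup-successor-adjacent (_ ∷⟨ _ ⟩ p) (suc i) (suc j) h =
    lookup-successor-adjacent p i j (ℕ.suc-injective h)

  adjacent-off-tail⇒first : ∀ {x u v} (p : Walk G u v) j → Adj x (lookup (vs p) j) →
                            All (¬_ ∘ Adj x) (tail p) → toℕ j ≡ 0
  adjacent-off-tail⇒first [ _ ] zero _ _ = refl
  adjacent-off-tail⇒first (_ ∷⟨ _ ⟩ _) zero _ _ = refl
  adjacent-off-tail⇒first (_ ∷⟨ _ ⟩ _) (suc j) e x≁tail =
    ⊥-elim (All.lookup x≁tail (∈-lookup j) e)

  lookup-adjacent⇒successor : ∀ {a b} (Q : Walk G a b) → IsInducedPath Q → ∀ i j →
                              Adj (lookup (vs Q) i) (lookup (vs Q) j) →
                              suc (toℕ i) ≡ toℕ j ⊎ suc (toℕ j) ≡ toℕ i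
  lookup-adjacent⇒successor [ _ ] _ zero zero e = ⊥-elim (irrefl e)
  lookup-adjacent⇒successor (_ ∷⟨ _ ⟩ _) _ zero zero e = ⊥-elim (irrefl e)
  lookup-adjacent⇒successor (_ ∷⟨ _ ⟩ p) (_ , a≁p , _) zero (suc j) e =
    inj₁ (cong suc (sym (adjacent-off-tail⇒first p j e a≁p)))
  lookup-adjacent⇒successor (_ ∷⟨ _ ⟩ p) (_ , a≁p , _) (suc i) zero e =
    inj₂ (cong suc (sym (adjacent-off-tail⇒first p i (Adj-sym e) a≁p)))
  lookup-adjacent⇒successor (_ ∷⟨ _ ⟩ p) (_ , _ , ind) (suc i) (suc j) e =
    ⊎-map (cong suc) (cong suc) (lookup-adjacent⇒successor p ind i j e)

  3≤length : ∀ {a b} (Q : Walk G a b) → a ≢ b → ¬ Adj a b → 3 ≤ length (vs Q)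
  3≤length [ _ ] a≢b _ = ⊥-elim (a≢b refl)
  3≤length (_ ∷⟨ e ⟩ [ _ ]) _ a≁b = ⊥-elim (a≁b e)
  3≤length (_ ∷⟨ _ ⟩ (_ ∷⟨ _ ⟩ p)) _ _ =
    ℕ.s≤s (ℕ.s≤s (subst (1 ≤_) (sym (length-vertices p)) (ℕ.s≤s ℕ.z≤n)))

  module ClosedByVertex
      (x : Fin n) {a b : Fin n} (Q : Walk G a b) (induced : IsInducedPath Q)
      (a≢b : a ≢ b) (a≁b : ¬ Adj a b) (x∉Q : All (x ≢_) (vs Q))
      (x~a : Adj x a) (x~b : Adj x b) (x~Q⇒end : All (λ w → Adj x w → w ≡ a ⊎ w ≡ b) (vs Q))
    where

    private
      vtx : Fin (suc (length (vs Q))) → Fin n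
      vtx = lookup (x ∷ vs Q)

      3≤|Q| : 3 ≤ length (vs Q)
      3≤|Q| = 3≤length Q a≢b a≁b

      x-edge : ∀ k → Consecutive G {suc (length (vs Q))} zero (suc k) → Adj x (lookup (vs Q) k)
      x-edge k (inj₁ h) = subst (Adj x) (sym (lookup-first Q k (sym (ℕ.suc-injective h)))) x~a
      x-edge k (inj₂ (inj₂ (inj₁ (_ , h)))) = subst (Adj x) (sym (lookup-last Q k h)) x~b

      edges : ∀ i j → Consecutive G i j → Adj (vtx i) (vtx j)
      edges zero zero (inj₂ (inj₂ (inj₁ (_ , h)))) with subst (3 ≤_) (sym h) 3≤|Q|
      ... | ()
      edges zero zero (inj₂ (inj₂ (inj₂ (_ , h)))) with subst (3 ≤_) (sym h) 3≤|Q|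
      ... | ()
      edges zero (suc k) c = x-edge k c
      edges (suc k) zero c = Adj-sym (x-edge k (Consecutive-sym c))
      edges (suc k) (suc l) (inj₁ h) = lookup-successor-adjacent Q k l (ℕ.suc-injective h)
      edges (suc k) (suc l) (inj₂ (inj₁ h)) =
        Adj-sym (lookup-successor-adjacent Q l k (ℕ.suc-injective h))
      edges (suc _) (suc _) (inj₂ (inj₂ (inj₁ (() , _))))
      edges (suc _) (suc _) (inj₂ (inj₂ (inj₂ (() , _))))

      adjacent⇒consecutive : ∀ i j → Adj (vtx i) (vtx j) → Consecutive G i j
      adjacent⇒consecutive zero zero e = ⊥-elim (irrefl e)
      adjacent⇒consecutive zero (suc k) e with All.lookup x~Q⇒end (∈-lookup k) e
      ... | inj₁ eq = inj₁ (cong suc (sym (lookup-first⁻ Q induced k eq)))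
      ... | inj₂ eq = inj₂ (inj₂ (inj₁ (refl , lookup-last⁻ Q induced k eq)))
      adjacent⇒consecutive (suc k) zero e =
        Consecutive-sym (adjacent⇒consecutive zero (suc k) (Adj-sym e))
      adjacent⇒consecutive (suc k) (suc l) e =
        ⊎-map (cong suc) (inj₁ ∘ cong suc) (lookup-adjacent⇒successor Q induced k l e)

      vtx-injective : ∀ i j → vtx i ≡ vtx j → i ≡ j
      vtx-injective zero zero _ = refl
      vtx-injective zero (suc k) eq = ⊥-elim (All.lookup x∉Q (∈-lookup k) eq)
      vtx-injective (suc k) zero eq = ⊥-elim (All.lookup x∉Q (∈-lookup k) (sym eq))
      vtx-injective (suc k) (suc l) eq =
        cong suc (lookup-injective (IsInducedPath⇒IsPath Q induced) k l eq)

    hole : Hole G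
    hole = record
      { len      = suc (length (vs Q))
      ; long     = ℕ.s≤s 3≤|Q|
      ; vtx      = vtx
      ; inj      = vtx-injective
      ; edges    = edges
      ; nonedges = λ i j ¬c e → ¬c (adjacent⇒consecutive i j e)
      }

    sparse⇒common-neighbour-adjacent : Sparse G → ∀ v {y} → y ∈ᴸ vs Q → All (v ≢_) (vs Q) →
                                        Adj v x → Adj v y → Adj x y
    sparse⇒common-neighbour-adjacent sparse v y∈Q v∉Q v~x v~y
      with sparse⇒neighbours-on-hole-adjacent sparse hole v v∉hole zero (suc (Any.index y∈Q))
             v~x (subst (Adj v) (lookup-index y∈Q) v~y)
      where
        v∉hole : ∀ i → vtx i ≢ v
        v∉hole zero refl = irrefl v~x
        v∉hole (suc k) eq = All.lookup v∉Q (∈-lookup k) (sym eq)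
    ... | inj₂ x~y = subst (Adj x) (sym (lookup-index y∈Q)) x~y

module SeparationProperties {n : ℕ} (G : Graph n) where
  open Graph G renaming (sym to Adj-sym)
  open WalkProperties G
  open Reachability G

  module _ {A C B : Subset n} (sep : Separation G A C B) where

    A∩C=∅ : ∀ w → w ∈ A → w ∉ C
    A∩C=∅ = proj₁ sep

    A∩B=∅ : ∀ w → w ∈ A → w ∉ B
    A∩B=∅ = proj₁ (proj₂ sep)

    C∩B=∅ : ∀ w → w ∈ C → w ∉ B
    C∩B=∅ = proj₁ (proj₂ (proj₂ sep))

    A∪C∪B : ∀ w → w ∈ A ⊎ w ∈ C ⊎ w ∈ B
    A∪C∪B = proj₁ (proj₂ (proj₂ (proj₂ sep)))

    A≁B : ∀ u w → u ∈ A → w ∈ B → ¬ Adj u w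
    A≁B = proj₂ (proj₂ (proj₂ (proj₂ sep)))

  module _ {D S : Subset n} (component : IsComponentOf G D S) where

    component-⊆ : D ⊆ S
    component-⊆ = proj₁ component

    component-connected : ∀ u w → u ∈ D → w ∈ D →
                          ∃[ p ] (IsPath G {u} {w} p × All (_∈ D) (vertices G p))
    component-connected = proj₁ (proj₂ (proj₂ component))

    component-closed : ∀ u w → u ∈ D → w ∈ S → Adj u w → w ∈ D
    component-closed = proj₂ (proj₂ (proj₂ component))

  ∃-component : ∀ {S : Subset n} {a} → a ∈ S → ∃ λ D → IsComponentOf G D S × a ∈ D
  ∃-component {S} {a} a∈S =
    D , (D⊆S , (a , a∈D) , connected , closed) , a∈D
    where
      reaches-a? : Decidable (ReachesWithin (_∈ S) (_≡ a))
      reaches-a? = reachesWithin? (_∈? S) (_≟ a)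

      D : Subset n
      D = toSubset reaches-a?

      D⊆S : D ⊆ S
      D⊆S w∈D = All-head _ (ReachesWithin.inside (∈-toSubset⁻ reaches-a? w∈D))

      a∈D : a ∈ D
      a∈D = ∈-toSubset⁺ reaches-a? (reaches [ a ] (a∈S ∷ []) refl)

      connected : ∀ u w → u ∈ D → w ∈ D →
                  ∃[ p ] (IsPath G {u} {w} p × All (_∈ D) (vertices G p))
      connected u w u∈D w∈D
        with ∈-toSubset⁻ reaches-a? u∈D | ∈-toSubset⁻ reaches-a? w∈D
      ... | reaches pu pu⊆S refl | reaches pw pw⊆S refl =
        let inducedSubpath q ind q⊆walk = shortcut (pu ++ʷ reverse pw)
        in q , IsInducedPath⇒IsPath q ind ,
           All.map (∈-toSubset⁺ reaches-a?)
             (All-resp-⊇ q⊆walk (All-++ʷ pu (reverse pw)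
               (All-reaches pu pu⊆S refl) (All-reverse pw (All-reaches pw pw⊆S refl))))

      closed : ∀ u w → u ∈ D → w ∈ S → Adj u w → w ∈ D
      closed u w u∈D w∈S u~w =
        ∈-toSubset⁺ reaches-a? (reaches-∷ w∈S (Adj-sym u~w) (∈-toSubset⁻ reaches-a? u∈D))

  meets-all-paths⇒separation :
    ∀ (K : Subset n) {D₁ D₂ : Subset n} →
    (∀ u w (p : Walk G u w) → u ∈ D₁ → w ∈ D₂ → IsPath G p → Any (_∈ K) (vertices G p)) →
    ∀ {a b} → a ∈ D₁ → a ∉ K → b ∈ D₂ → b ∉ K →
    ∃ λ A′ → ∃ λ B′ → Separation G A′ K B′ × a ∈ A′ × b ∈ B′
  meets-all-paths⇒separation K {D₁} {D₂} K-meets {a} {b} a∈D₁ a∉K b∈D₂ b∉K =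
    A′ , B′ , (A′∩K=∅ , A′∩B′=∅ , K∩B′=∅ , covers , A′≁B′) , a∈A′ , b∈B′
    where
      reaches? : Decidable (ReachesWithin (_∉ K) (_∈ D₁))
      reaches? = reachesWithin? (¬? ∘ (_∈? K)) (_∈? D₁)

      A′ : Subset n
      A′ = toSubset reaches?

      outside? : Decidable (λ w → w ∉ A′ × w ∉ K)
      outside? w = ¬? (w ∈? A′) ×-dec ¬? (w ∈? K)

      B′ : Subset n
      B′ = toSubset outside?

      A′∩K=∅ : ∀ w → w ∈ A′ → w ∉ K
      A′∩K=∅ w w∈A′ = All-head _ (ReachesWithin.inside (∈-toSubset⁻ reaches? w∈A′))

      A′∩B′=∅ : ∀ w → w ∈ A′ → w ∉ B′
      A′∩B′=∅ w w∈A′ w∈B′ = proj₁ (∈-toSubset⁻ outside? w∈B′) w∈A′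

      K∩B′=∅ : ∀ w → w ∈ K → w ∉ B′
      K∩B′=∅ w w∈K w∈B′ = proj₂ (∈-toSubset⁻ outside? w∈B′) w∈K

      covers : ∀ w → w ∈ A′ ⊎ w ∈ K ⊎ w ∈ B′
      covers w with w ∈? A′ | w ∈? K
      ... | yes w∈A′ | _ = inj₁ w∈A′
      ... | no _ | yes w∈K = inj₂ (inj₁ w∈K)
      ... | no w∉A′ | no w∉K = inj₂ (inj₂ (∈-toSubset⁺ outside? (w∉A′ , w∉K)))

      A′≁B′ : ∀ u w → u ∈ A′ → w ∈ B′ → ¬ Adj u w
      A′≁B′ u w u∈A′ w∈B′ u~w =
        let w∉A′ , w∉K = ∈-toSubset⁻ outside? w∈B′
        in w∉A′ (∈-toSubset⁺ reaches?
                   (reaches-∷ w∉K (Adj-sym u~w) (∈-toSubset⁻ reaches? u∈A′)))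

      a∈A′ : a ∈ A′
      a∈A′ = ∈-toSubset⁺ reaches? (reaches [ a ] (a∉K ∷ []) a∈D₁)

      b∉A′ : b ∉ A′
      b∉A′ b∈A′ with ∈-toSubset⁻ reaches? b∈A′
      ... | reaches p p∌K d∈D₁ =
        let inducedSubpath q ind q⊆p = shortcut (reverse p)
        in All¬⇒¬Any (All-resp-⊇ q⊆p (All-reverse p p∌K))
                     (K-meets _ _ q d∈D₁ b∈D₂ (IsInducedPath⇒IsPath q ind))

      b∈B′ : b ∈ B′
      b∈B′ = ∈-toSubset⁺ outside? (b∉A′ , b∉K)

module SeparatingCliques
    {n : ℕ} (G : Graph n) (sparse : Sparse G)
    {A C B : Subset n} (sep : Separation G A C B)
    {k : ℕ} (v : Fin k → Fin n) (v∈C : ∀ i → v i ∈ C)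
    (C⊆⋃N[v] : ∀ u → u ∈ C → ∃[ i ] N[_] G (v i) u)
    {D₁ D₂ : Subset n} (D₁-component : IsComponentOf G D₁ A) (D₂-component : IsComponentOf G D₂ B)
  where
  open Graph G renaming (sym to Adj-sym)
  open WalkProperties G
  open Reachability G
  open HoleProperties G
  open SeparationProperties G

  private
    D₁⊆A : D₁ ⊆ A
    D₁⊆A = component-⊆ D₁-component

    D₂⊆B : D₂ ⊆ B
    D₂⊆B = component-⊆ D₂-component

  ∂D₁ : Fin n → Set
  ∂D₁ = Boundary (_∈ D₁)

  ∂D₁? : Decidable ∂D₁
  ∂D₁? = boundary? (_∈? D₁)

  ∂D₁⊆C : ∀ {w} → ∂D₁ w → w ∈ C
  ∂D₁⊆C {w} (w∉D₁ , d , d∈D₁ , w~d) with A∪C∪B sep w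
  ... | inj₁ w∈A = ⊥-elim (w∉D₁ (component-closed D₁-component d w d∈D₁ w∈A (Adj-sym w~d)))
  ... | inj₂ (inj₁ w∈C) = w∈C
  ... | inj₂ (inj₂ w∈B) = ⊥-elim (A≁B sep d w (D₁⊆A d∈D₁) w∈B (Adj-sym w~d))

  D₂∩D₁=∅ : ∀ {w} → w ∈ D₂ → w ∉ D₁
  D₂∩D₁=∅ w∈D₂ w∈D₁ = A∩B=∅ sep _ (D₁⊆A w∈D₁) (D₂⊆B w∈D₂)

  Far : Fin k → Fin n → Set
  Far i w = w ∉ D₁ × ¬ ∂D₁ w × w ≢ v i

  Far? : ∀ i → Decidable (Far i)
  Far? i w = ¬? (w ∈? D₁) ×-dec (¬? (∂D₁? w) ×-dec ¬? (w ≟ v i))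

  D₂⊆Far : ∀ i {w} → w ∈ D₂ → Far i w
  D₂⊆Far i {w} w∈D₂ =
    D₂∩D₁=∅ w∈D₂ , (λ w∂ → C∩B=∅ sep w (∂D₁⊆C w∂) (D₂⊆B w∈D₂)) ,
    λ { refl → C∩B=∅ sep w (v∈C i) (D₂⊆B w∈D₂) }

  ReachesD₂ : Fin k → Fin n → Set
  ReachesD₂ i = ReachesWithin (Far i) (_∈ D₂)

  NeighbourReachesD₂ : Fin k → Fin n → Set
  NeighbourReachesD₂ i x = ∃ λ r → Adj x r × ReachesD₂ i r

  Attached : Fin k → Fin n → Set
  Attached i x = Adj x (v i) × ∂D₁ x × NeighbourReachesD₂ i x

  Attached? : ∀ i → Decidable (Attached i)
  Attached? i x =
    adj? x (v i) ×-dec (∂D₁? x ×-dec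
      any? (λ r → adj? x r ×-dec reachesWithin? (Far? i) (_∈? D₂) r))

  InX? : ∀ i → Decidable (λ x → x ≡ v i ⊎ Attached i x)
  InX? i x = (x ≟ v i) ⊎-dec Attached? i x

  X : Fin k → Subset n
  X i = toSubset (InX? i)

  X⊆C : ∀ i → X i ⊆ C
  X⊆C i x∈X with ∈-toSubset⁻ (InX? i) x∈X
  ... | inj₁ refl = v∈C i
  ... | inj₂ (_ , x∂ , _) = ∂D₁⊆C x∂

  InSomeX : Fin n → Set
  InSomeX w = ∃[ i ] w ∈ X i

  walk-from-last-boundary-vertex-meets-X :
    ∀ {c w} (q : Walk G c w) → ∂D₁ c → All (¬_ ∘ ∂D₁) (tail q) → w ∈ D₂ →
    Any InSomeX (vertices G q)
  walk-from-last-boundary-vertex-meets-X [ c ] c∂ _ c∈D₂ =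
    ⊥-elim (C∩B=∅ sep c (∂D₁⊆C c∂) (D₂⊆B c∈D₂))
  walk-from-last-boundary-vertex-meets-X (c ∷⟨ e ⟩ q) c∂ q∌∂ w∈D₂
    with C⊆⋃N[v] c (∂D₁⊆C c∂)
  ... | i , inj₁ c≡v = here (i , ∈-toSubset⁺ (InX? i) (inj₁ c≡v))
  ... | i , inj₂ c~v with Any.any? (_≟ v i) (vertices G q)
  ...   | yes v∈q = there (Any.map (λ u≡v → i , ∈-toSubset⁺ (InX? i) (inj₁ u≡v)) v∈q)
  ...   | no v∉q =
    here (i , ∈-toSubset⁺ (InX? i) (inj₂ (c~v , c∂ , _ , e , reaches q q-far w∈D₂)))
    where
      q-far : All (Far i) (vertices G q)
      q-far = All.zip (boundary-avoiding-walk-stays-outside q (D₂∩D₁=∅ w∈D₂) q∌∂ ,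
                       All.zip (q∌∂ , ¬Any⇒All¬ _ v∉q))

  X-separates : ∀ {u w} (p : Walk G u w) → u ∈ D₁ → w ∈ D₂ → Any InSomeX (vertices G p)
  X-separates p u∈D₁ w∈D₂ =
    let lastSatisfying q q⊆p c∂ q∌∂ = lastSatisfying? ∂D₁? p
          (leaving-walk-meets-boundary (_∈? D₁) p u∈D₁ (D₂∩D₁=∅ w∈D₂))
    in Any-resp-⊆ (Suffix⇒⊆ q⊆p) (walk-from-last-boundary-vertex-meets-X q c∂ q∌∂ w∈D₂)

  Zone : Fin k → Fin n → Fin n → Set
  Zone i y w = w ∈ D₁ ⊎ w ≡ y ⊎ Far i w

  record Detour (i : Fin k) (x y : Fin n) : Set where
    field
      {start end} : Fin n
      walk        : Walk G start end
      start∈D₁    : start ∈ D₁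
      end-far     : Far i end
      x~start     : Adj x start
      x~end       : Adj x end
      in-zone     : All (Zone i y) (vertices G walk)
      x~walk⇒ends : All (λ w → Adj x w → w ≡ start ⊎ w ≡ end) (vertices G walk)

  detour : ∀ i {x y} → ∂D₁ x → NeighbourReachesD₂ i x → ∂D₁ y → NeighbourReachesD₂ i y →
           ¬ Adj x y → Detour i x y
  detour i {x} {y} (_ , dx , dx∈D₁ , x~dx) (rx , x~rx , reaches {sx} wx wx-far sx∈D₂)
                   (_ , dy , dy∈D₁ , y~dy) (ry , y~ry , reaches {sy} wy wy-far sy∈D₂) x≁y
    with component-connected D₁-component dx dy dx∈D₁ dy∈D₁
       | component-connected D₂-component sx sy sx∈D₂ sy∈D₂
  ... | p₁ , _ , p₁⊆D₁ | p₂ , _ , p₂⊆D₂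
    with lastNeighbourSegment x p₁ x~dx p₁⊆D₁
       | lastNeighbourSegment x (wx ++ʷ (p₂ ++ʷ reverse wy)) x~rx
           (All-++ʷ wx _ wx-far (All-++ʷ p₂ _ (All.map (D₂⊆Far i) p₂⊆D₂) (All-reverse wy wy-far)))
  ... | segment q₁ x~a q₁⊆D₁ x~q₁⇒a | segment q₂ x~b q₂-far x~q₂⇒b = record
    { walk        = q₁ ++ʷ (dy ∷⟨ Adj-sym y~dy ⟩ (y ∷⟨ y~ry ⟩ reverse q₂))
    ; start∈D₁    = All-head q₁ q₁⊆D₁
    ; end-far     = All-head q₂ q₂-far
    ; x~start     = x~a
    ; x~end       = x~b
    ; in-zone     = All-++ʷ q₁ _ (All.map inj₁ q₁⊆D₁)
                      (inj₁ dy∈D₁ ∷ inj₂ (inj₁ refl) ∷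
                       All-reverse q₂ (All.map (inj₂ ∘ inj₂) q₂-far))
    ; x~walk⇒ends = All-++ʷ q₁ _ (All.map (inj₁ ∘_) x~q₁⇒a)
                      ((inj₁ ∘ All.lookup x~q₁⇒a (last∈vertices q₁)) ∷ (⊥-elim ∘ x≁y) ∷
                       All-reverse q₂ (All.map (inj₂ ∘_) x~q₂⇒b))
    }

  attached-adjacent : ∀ i {x y} → Attached i x → Attached i y → x ≢ y → Adj x y
  attached-adjacent i {x} {y} (x~v , x∂ , x-reach) (y~v , y∂ , y-reach) x≢y with adj? x y
  ... | yes x~y = x~y
  ... | no x≁y =
    ⊥-elim (x≁y (sparse⇒common-neighbour-adjacent sparse (v i) y∈Q (All.map v∉zone Q-zone)
                   (Adj-sym x~v) (Adj-sym y~v)))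
    where
      open Detour (detour i x∂ x-reach y∂ y-reach x≁y)
      open InducedSubpath (shortcut walk) renaming (path to Q; ⊆walk to Q⊆walk)

      Q-zone : All (Zone i y) (vertices G Q)
      Q-zone = All-resp-⊇ Q⊆walk in-zone

      start≁end : ¬ Adj start end
      start≁end e = proj₁ (proj₂ end-far) (proj₁ end-far , start , start∈D₁ , Adj-sym e)

      start≢end : start ≢ end
      start≢end eq = proj₁ end-far (subst (_∈ D₁) eq start∈D₁)

      x∉zone : ∀ {w} → Zone i y w → x ≢ w
      x∉zone (inj₁ w∈D₁) refl = proj₁ x∂ w∈D₁
      x∉zone (inj₂ (inj₁ refl)) refl = x≢y refl
      x∉zone (inj₂ (inj₂ w-far)) refl = proj₁ (proj₂ w-far) x∂

      v∉zone : ∀ {w} → Zone i y w → v i ≢ w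
      v∉zone (inj₁ w∈D₁) refl = A∩C=∅ sep _ (D₁⊆A w∈D₁) (v∈C i)
      v∉zone (inj₂ (inj₁ refl)) refl = irrefl y~v
      v∉zone (inj₂ (inj₂ w-far)) refl = proj₂ (proj₂ w-far) refl

      boundary-in-zone-is-y : ∀ {w} → Zone i y w → ∂D₁ w → y ≡ w
      boundary-in-zone-is-y (inj₁ w∈D₁) w∂ = ⊥-elim (proj₁ w∂ w∈D₁)
      boundary-in-zone-is-y (inj₂ (inj₁ refl)) _ = refl
      boundary-in-zone-is-y (inj₂ (inj₂ w-far)) w∂ = ⊥-elim (proj₁ (proj₂ w-far) w∂)

      y∈Q : y ∈ᴸ vertices G Q
      y∈Q = Any-map-All (All.map boundary-in-zone-is-y Q-zone)
              (leaving-walk-meets-boundary (_∈? D₁) Q start∈D₁ (proj₁ end-far))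

      open ClosedByVertex x Q induced start≢end start≁end (All.map x∉zone Q-zone) x~start x~end
                          (All-resp-⊇ Q⊆walk x~walk⇒ends)

  X-clique : ∀ i → IsClique G (X i)
  X-clique i x y x∈X y∈X x≢y with ∈-toSubset⁻ (InX? i) x∈X | ∈-toSubset⁻ (InX? i) y∈X
  ... | inj₁ refl | inj₁ refl = ⊥-elim (x≢y refl)
  ... | inj₁ refl | inj₂ (y~v , _) = Adj-sym y~v
  ... | inj₂ (x~v , _) | inj₁ refl = x~v
  ... | inj₂ x-attached | inj₂ y-attached = attached-adjacent i x-attached y-attached x≢y

star-cutset⇒clique-cutset : ∀ {n} (G : Graph n) → Sparse G → AdmitsStarCutset G → AdmitsCliqueCutset G
star-cutset⇒clique-cutset G sparse (A , C , B , (sep , c , c∈C , C⊆N[c]) , (a , a∈A) , (b , b∈B))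
  with SeparationProperties.∃-component G a∈A | SeparationProperties.∃-component G b∈B
... | D₁ , D₁-component , a∈D₁ | D₂ , D₂-component , b∈D₂ =
  let A′ , B′ , sep′ , a∈A′ , b∈B′ =
        meets-all-paths⇒separation K
          (λ _ _ p u∈D₁ w∈D₂ _ → Any.map X₀ (X-separates p u∈D₁ w∈D₂))
          a∈D₁ (λ a∈K → A∩C=∅ sep a a∈A (X⊆C zero a∈K))
          b∈D₂ (λ b∈K → C∩B=∅ sep b (X⊆C zero b∈K) b∈B)
  in A′ , K , B′ , sep′ , (a , a∈A′) , (b , b∈B′) , X-clique zero
  where
    open SeparationProperties G
    open SeparatingCliques G sparse sep {k = 1} (λ _ → c) (λ _ → c∈C)
                           (λ u u∈C → zero , C⊆N[c] u u∈C) D₁-component D₂-component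

    K : Subset _
    K = X zero

    X₀ : ∀ {w} → InSomeX w → w ∈ K
    X₀ (zero , w∈K) = w∈K
    X₀ (suc () , _)

lemma2p1 : ∀ {n} (G : Graph n) → Sparse G →
    (∀ (A C B : Subset n) → Separation G A C B → NonEmpty G A → NonEmpty G B →
      ∀ (k : ℕ) (vs : Fin k → Fin n) → (∀ i → vs i ∈ C) →
      (∀ u → u ∈ C → ∃[ i ] N[_] G (vs i) u) →
      ∀ (D₁ D₂ : Subset n) → IsComponentOf G D₁ A → IsComponentOf G D₂ B →
      Σ (Fin k → Subset n) λ X → ((∀ (i : Fin k) → (X i ⊆ C) × IsClique G (X i)) ×
        (∀ u v (p : Walk G u v) → u ∈ D₁ → v ∈ D₂ → IsPath G p →
          Any (λ w → ∃[ i ] w ∈ X i) (vertices G p))))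
    × (AdmitsStarCutset G → AdmitsCliqueCutset G)
lemma2p1 G sparse =
  (λ A C B sep _ _ k v v∈C C⊆⋃N[v] D₁ D₂ D₁-component D₂-component →
    let open SeparatingCliques G sparse sep v v∈C C⊆⋃N[v] D₁-component D₂-component
    in X , (λ i → X⊆C i , X-clique i) , (λ _ _ p u∈D₁ w∈D₂ _ → X-separates p u∈D₁ w∈D₂))
  , star-cutset⇒clique-cutset G sparse
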